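{- Let $S\neq\mathbb{N}$ be a numerical set with complement $\widetilde{S}$. (a) $F(\widetilde{S})\le B(S)-1\le F(S)-2$. Furthermore, if $1\notin S$ then $F(\widetilde{S})=B(S)-1$. (b) $g(\widetilde{S})=g(S)+B(S)-F(S)$. (c) If $\widetilde{S}\neq\mathbb{N}$, then $B(\widetilde{S})\le B(S)-m(S)$, with equality if and only if $1\notin S$.
   Context: $\mathbb{N}=\{0,1,2,\dots\}$. A numerical set is a subset $S\subseteq\mathbb{N}$ with $0\in S$ and $\mathbb{N}\setminus S$ finite. The elements of $\mathbb{N}\setminus S$ are the gaps of $S$. - $F(S)$ is the largest gap, with the convention $F(\mathbb{N})=-1$. - $g(S)$ is the number of gaps. - $m(S)$ is the smallest positive element of $S$ (the multiplicity). - For $S\neq\mathbb{N}$, the base is $B(S)=\max\{s\in S\mid s<F(S)\}$. Young diagram of $S$: it has one left-justified row for each gap $\ell$ of $S$. The top row corresponds to $F(S)$, and the gaps decrease going down. The row for $\ell$ has length $|\{s\in S\mid s<\ell\}|$. This is a bijection between numerical sets and Young diagrams, with $\mathbb{N}$ corresponding to the empty diagram. Complement of a Young diagram with row lengths $\lambda_1\ge\dots\ge\lambda_g$: it is the Young diagram with row lengths $\lambda_1-\lambda_g\ge\lambda_1-\lambda_{g-1}\ge\dots\ge\lambda_1-\lambda_1$, zero-length rows being discarded. Equivalently, take the part of the $g\times\lambda_1$ rectangle not in the diagram and rotate it by $180^\circ$. The complement $\widetilde{S}$ is the numerical set whose Young diagram is the complement of that of $S$. For $S\neq\mathbb{N}$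 this is equivalently $\widetilde{S}=\{B(S)-s\mid s\in S,\ s\le B(S)\}\cup\{n\in\mathbb{N}\mid n\ge B(S)\}$. -}

module Defs where

open import Data.Bool using (Bool; true; false; not; if_then_else_)
open import Data.Nat using (ℕ; zero; suc; _≤_; _∸_; _≡ᵇ_)
open import Data.List using (List; []; _∷_; filter; length; map; reverse; upTo; foldl)
open import Data.Maybe using (Maybe; just; nothing)
open import Data.Integer using (ℤ; +_; -[1+_])
open import Relation.Binary.PropositionalEquality using (_≡_)
open import Relation.Nullary using (¬_)
open import Relation.Nullary.Decidable using (does)
open import Data.Bool.Properties using (T?)

record NumericalSet : Set where
  field
    mem      : ℕ → Bool
    zero∈    : mem 0 ≡ true
    bound    : ℕ
    cofinite : ∀ n → bound ≤ n → mem n ≡ true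
open NumericalSet public

IsFullℕ : NumericalSet → Set
IsFullℕ S = ∀ n → mem S n ≡ true

-- the gaps of S, in increasing order (independent of the chosen bound)
gaps : NumericalSet → List ℕ
gaps S = filter (λ n → T? (not (mem S n))) (upTo (bound S))

genus : NumericalSet → ℕ
genus S = length (gaps S)

maxList : List ℕ → Maybe ℕ
maxList = foldl (λ acc x → just (Data.Nat._⊔_ (fromMaybe0 acc) x)) nothing
  where
  fromMaybe0 : Maybe ℕ → ℕ
  fromMaybe0 nothing  = 0
  fromMaybe0 (just k) = k

frobenius : NumericalSet → ℤ
frobenius S with maxList (gaps S)
... | nothing = -[1+ 0 ]
... | just f  = + f

-- largest s ≤ k with s ∈ S (0 ∈ S makes this total)
largestMemBelow : NumericalSet → ℕ → ℕ
largestMemBelow S zero    = 0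
largestMemBelow S (suc k) = if mem S (suc k) then suc k else largestMemBelow S k

-- B(S) = max { s ∈ S | s < F(S) }, meaningful for S ≠ ℕ (then F(S) ≥ 1);
-- the value for S = ℕ is an irrelevant default.
base : NumericalSet → ℤ
base S with maxList (gaps S)
... | nothing = + 0
... | just f  = + largestMemBelow S (f ∸ 1)

firstMemFrom : NumericalSet → ℕ → ℕ → ℕ
firstMemFrom S zero       k = k
firstMemFrom S (suc fuel) k = if mem S k then k else firstMemFrom S fuel (suc k)

-- m(S): smallest positive element (bound + 1 ∈ S, so searching 1..bound+1 suffices)
multiplicity : NumericalSet → ℕ
multiplicity S = firstMemFrom S (bound S) 1

-- Young diagrams: list of row lengths, top row first
YoungDiagram : Set
YoungDiagram = List ℕ

countBelow : NumericalSet → ℕ → ℕ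
countBelow S ℓ = length (filter (λ n → T? (mem S n)) (upTo ℓ))

-- one row per gap ℓ, top row for F(S), gaps decreasing downwards
youngDiagram : NumericalSet → YoungDiagram
youngDiagram S = map (countBelow S) (reverse (gaps S))

complementDiagram : YoungDiagram → YoungDiagram
complementDiagram []          = []
complementDiagram (l₁ ∷ rest) =
  filter (λ r → T? (not (r ≡ᵇ 0))) (map (l₁ ∸_) (reverse (l₁ ∷ rest)))

IsComplement : NumericalSet → NumericalSet → Set
IsComplement S T = youngDiagram T ≡ complementDiagram (youngDiagram S)

-- Let λ₁ ≥ … ≥ λ_g be the Young diagram of S ≠ ℕ, so that F(S) = λ₁ + g − 1. The gaps in
-- (B(S), F(S)] are exactly those with λ₁ members below them, so F(S) − B(S) is the number r ≥ 1
-- of rows of length λ₁. These are the rows the complement discards, so g(S̃) = g(S) − r, which is (b).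
-- If S̃ ≠ ℕ, its top row is λ₁ − c for the shortest row c of S, and its rows of that length come
-- from the rows of length c; the identity above, applied to S̃, gives F(S̃) = B(S) − c and
-- B(S̃) = F(S̃) − #{rows of length c}. The rows of length 1 belong to the gaps 1, …, m(S) − 1: if
-- 1 ∉ S they exist, so c = 1 and B(S̃) = B(S) − m(S); if 1 ∈ S then m(S) = 1 and B(S̃) ≤ B(S) − 2.
-- If S̃ = ℕ, all rows of S have length λ₁, which 1 ∉ S forces to be 1, and then B(S) = 0.

module Submission where

open import Defs
open import Data.Bool using (true; false; not; T; if_then_else_)
open import Data.List using (List; []; _∷_; _++_; _∷ʳ_; filter; length; map; reverse; upTo; foldl)
open import Data.List.Membership.Propositional using (_∈_)
open import Data.List.Relation.Unary.All as All using (All; []; _∷_)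
open import Data.Product using (∃; _×_; _,_; proj₁; proj₂)
open import Data.Empty using (⊥-elim)
open import Data.Maybe using (Maybe; just; nothing)
open import Function using (_∘_)
open import Relation.Nullary using (¬_; Dec; yes; no)
open import Relation.Binary.PropositionalEquality

-- The operators of ℕ are opened only in this module; the statement of the theorem uses those of ℤ.
module YoungDiagrams where

  open import Data.Bool.Properties using (T?)
  open import Data.Nat using (ℕ; zero; suc; _+_; _∸_; _≤_; _<_; _⊔_; _≡ᵇ_; z≤n; s≤s)
  open import Data.Nat.Properties
  open import Data.List.Properties
    using (∷-injectiveˡ; ∷-injectiveʳ; unfold-reverse; reverse-map; reverse-++; length-map; length-reverse;
           length-++; upTo-∷ʳ; filter-++; ++-identityʳ; foldl-∷ʳ)
  open import Data.List.Membership.Propositional.Properties using (∈-map⁻)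
  open import Data.List.Relation.Unary.Any using (here; there)
  open import Data.Maybe.Properties using (just-injective)
  open import Data.Sum using (inj₁; inj₂)
  open import Relation.Unary using (Decidable)

  count : ℕ → List ℕ → ℕ
  count x []       = 0
  count x (y ∷ ys) with x ≟ y
  ... | yes _ = suc (count x ys)
  ... | no  _ = count x ys

  count-head : ∀ x ys → count x (x ∷ ys) ≡ suc (count x ys)
  count-head x ys with x ≟ x
  ... | yes _  = refl
  ... | no x≢x = ⊥-elim (x≢x refl)

  count-head-positive : ∀ x ys → 0 < count x (x ∷ ys)
  count-head-positive x ys = subst (0 <_) (sym (count-head x ys)) (s≤s z≤n)

  count-≢ : ∀ {x y} ys → x ≢ y → count x (y ∷ ys) ≡ count x ys
  count-≢ {x} {y} ys x≢y with x ≟ y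
  ... | yes x≡y = ⊥-elim (x≢y x≡y)
  ... | no  _   = refl

  count-≤-length : ∀ x ys → count x ys ≤ length ys
  count-≤-length x []       = z≤n
  count-≤-length x (y ∷ ys) with x ≟ y
  ... | yes _ = s≤s (count-≤-length x ys)
  ... | no  _ = m≤n⇒m≤1+n (count-≤-length x ys)

  count-++ : ∀ x xs ys → count x (xs ++ ys) ≡ count x xs + count x ys
  count-++ x []       ys = refl
  count-++ x (y ∷ xs) ys with x ≟ y
  ... | yes _ = cong suc (count-++ x xs ys)
  ... | no  _ = count-++ x xs ys

  count-reverse : ∀ x xs → count x (reverse xs) ≡ count x xs
  count-reverse x []       = refl
  count-reverse x (y ∷ ys) = begin
    count x (reverse (y ∷ ys))              ≡⟨ cong (count x) (unfold-reverse y ys) ⟩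
    count x (reverse ys ++ y ∷ [])          ≡⟨ count-++ x (reverse ys) (y ∷ []) ⟩
    count x (reverse ys) + count x (y ∷ []) ≡⟨ cong (_+ count x (y ∷ [])) (count-reverse x ys) ⟩
    count x ys + count x (y ∷ [])           ≡⟨ last-step ⟩
    count x (y ∷ ys)                        ∎
    where
    open ≡-Reasoning
    last-step : count x ys + count x (y ∷ []) ≡ count x (y ∷ ys)
    last-step with x ≟ y
    ... | yes _ = +-comm (count x ys) 1
    ... | no  _ = +-identityʳ (count x ys)

  ∈⇒count-pos : ∀ {x xs} → x ∈ xs → 0 < count x xs
  ∈⇒count-pos {x} {y ∷ ys} x∈ with x ≟ y | x∈
  ... | yes _   | _          = s≤s z≤n
  ... | no x≢y  | here x≡y   = ⊥-elim (x≢y x≡y)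
  ... | no _    | there x∈ys = ∈⇒count-pos x∈ys

  count-pos⇒∈ : ∀ {x} xs → 0 < count x xs → x ∈ xs
  count-pos⇒∈ {x} (y ∷ ys) pos with x ≟ y
  ... | yes x≡y = here x≡y
  ... | no  _   = there (count-pos⇒∈ ys pos)

  count-absent : ∀ {x} xs → All (_< x) xs → count x xs ≡ 0
  count-absent []       []           = refl
  count-absent (y ∷ ys) (y<x ∷ ys<x) =
    trans (count-≢ ys (λ x≡y → <-irrefl (sym x≡y) y<x)) (count-absent ys ys<x)

  count≡length⇒all-≡ : ∀ {a y} xs → count a xs ≡ length xs → y ∈ xs → y ≡ a
  count≡length⇒all-≡ {a} {y} (x ∷ xs) full y∈ with a ≟ x | y∈
  ... | yes refl | here y≡x   = y≡x
  ... | yes refl | there y∈xs = count≡length⇒all-≡ xs (suc-injective full) y∈xs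
  ... | no  _    | _          = ⊥-elim (<-irrefl refl (subst (_≤ length xs) full (count-≤-length a xs)))

  count-map-∸ : ∀ {a c} xs → All (_≤ a) xs → c ≤ a → count (a ∸ c) (map (a ∸_) xs) ≡ count c xs
  count-map-∸ []       []             c≤a = refl
  count-map-∸ {a} {c} (x ∷ xs) (x≤a ∷ xs≤a) c≤a with c ≟ x
  ... | yes refl = trans (count-head (a ∸ c) (map (a ∸_) xs)) (cong suc (count-map-∸ xs xs≤a c≤a))
  ... | no  c≢x  =
    trans (count-≢ (map (a ∸_) xs) (c≢x ∘ ∸-cancelˡ-≡ c≤a x≤a)) (count-map-∸ xs xs≤a c≤a)

  dropZeros : List ℕ → List ℕ
  dropZeros = filter (λ r → T? (not (r ≡ᵇ 0)))

  length-dropZeros : ∀ xs → length (dropZeros xs) + count 0 xs ≡ length xs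
  length-dropZeros []           = refl
  length-dropZeros (zero  ∷ xs) = begin
    length (dropZeros xs) + count 0 (0 ∷ xs)   ≡⟨ cong (length (dropZeros xs) +_) (count-head 0 xs) ⟩
    length (dropZeros xs) + suc (count 0 xs)   ≡⟨ +-suc _ _ ⟩
    suc (length (dropZeros xs) + count 0 xs)   ≡⟨ cong suc (length-dropZeros xs) ⟩
    suc (length xs)                            ∎
    where open ≡-Reasoning
  length-dropZeros (suc k ∷ xs) =
    cong suc (trans (cong (length (dropZeros xs) +_) (count-≢ {y = suc k} xs λ ())) (length-dropZeros xs))

  count-dropZeros : ∀ {y} xs → y ≢ 0 → count y (dropZeros xs) ≡ count y xs
  count-dropZeros []           y≢0 = refl
  count-dropZeros (zero  ∷ xs) y≢0 = trans (count-dropZeros xs y≢0) (sym (count-≢ xs y≢0))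
  count-dropZeros {y} (suc k ∷ xs) y≢0 with y ≟ suc k
  ... | yes _ = cong suc (count-dropZeros xs y≢0)
  ... | no  _ = count-dropZeros xs y≢0

  dropZeros-positive : ∀ xs → All (0 <_) (dropZeros xs)
  dropZeros-positive []           = []
  dropZeros-positive (zero  ∷ xs) = dropZeros-positive xs
  dropZeros-positive (suc k ∷ xs) = s≤s z≤n ∷ dropZeros-positive xs

  module _ {a : ℕ} {rest : List ℕ} where

    private
      D = a ∷ rest

    count-complementDiagram : ∀ {y} → y ≢ 0 → count y (complementDiagram D) ≡ count y (map (a ∸_) D)
    count-complementDiagram {y} y≢0 = begin
      count y (dropZeros (map (a ∸_) (reverse D))) ≡⟨ count-dropZeros (map (a ∸_) (reverse D)) y≢0 ⟩
      count y (map (a ∸_) (reverse D))             ≡⟨ cong (count y) (reverse-map (a ∸_) D) ⟩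
      count y (reverse (map (a ∸_) D))             ≡⟨ count-reverse y (map (a ∸_) D) ⟩
      count y (map (a ∸_) D)                       ∎
      where open ≡-Reasoning

    -- the rows of maximal length a are exactly the ones that become empty
    length-complementDiagram : All (_≤ a) rest →
      length (complementDiagram D) + count a D ≡ suc (length rest)
    length-complementDiagram rest≤a = begin
      length (dropZeros M) + count a D ≡⟨ cong (length (dropZeros M) +_) (sym zeros) ⟩
      length (dropZeros M) + count 0 M ≡⟨ length-dropZeros M ⟩
      length M                         ≡⟨ trans (length-map (a ∸_) (reverse D)) (length-reverse D) ⟩
      suc (length rest)                ∎
      where
      open ≡-Reasoning
      M = map (a ∸_) (reverse D)
      zeros : count 0 M ≡ count a D
      zeros = begin
        count 0 M                        ≡⟨ cong (count 0) (reverse-map (a ∸_) D) ⟩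
        count 0 (reverse (map (a ∸_) D)) ≡⟨ count-reverse 0 (map (a ∸_) D) ⟩
        count 0 (map (a ∸_) D)           ≡⟨ cong (λ z → count z (map (a ∸_) D)) (sym (n∸n≡0 a)) ⟩
        count (a ∸ a) (map (a ∸_) D)     ≡⟨ count-map-∸ D (≤-refl ∷ rest≤a) ≤-refl ⟩
        count a D                        ∎

    -- Asking the head b to bound rest' (true of any Young diagram) spares proving that
    -- complementDiagram produces a non-increasing list.
    complementDiagram-head : ∀ {b rest'} → All (_≤ a) rest → complementDiagram D ≡ b ∷ rest' →
      All (_≤ b) rest' →
      ∃ λ c → c ∈ D × All (c ≤_) D × b + c ≡ a × count b (b ∷ rest') ≡ count c D
    complementDiagram-head {b} {rest'} rest≤a compl≡ rest'≤b =
      c , c∈D , All.tabulate c≤ , b+c≡a , count-b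
      where
      D≤a : All (_≤ a) D
      D≤a = ≤-refl ∷ rest≤a
      count-compl : ∀ {y} → y ≢ 0 → count y (b ∷ rest') ≡ count y (map (a ∸_) D)
      count-compl y≢0 = trans (cong (count _) (sym compl≡)) (count-complementDiagram y≢0)
      ∈-compl : ∀ {y} → y ≢ 0 → 0 < count y (map (a ∸_) D) → y ∈ b ∷ rest'
      ∈-compl {y} y≢0 pos = count-pos⇒∈ (b ∷ rest') (subst (0 <_) (sym (count-compl y≢0)) pos)
      b≢0 : b ≢ 0
      b≢0 with subst (All (0 <_)) compl≡ (dropZeros-positive (map (a ∸_) (reverse D)))
      ... | 0<b ∷ _ = λ b≡0 → <-irrefl (sym b≡0) 0<b
      b∈ : b ∈ map (a ∸_) D
      b∈ = count-pos⇒∈ (map (a ∸_) D)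
             (subst (0 <_) (count-compl b≢0) (∈⇒count-pos {xs = b ∷ rest'} (here refl)))
      preimage = ∈-map⁻ (a ∸_) {xs = D} b∈
      c : ℕ
      c = proj₁ preimage
      c∈D : c ∈ D
      c∈D = proj₁ (proj₂ preimage)
      b≡a∸c : b ≡ a ∸ c
      b≡a∸c = proj₂ (proj₂ preimage)
      c≤a : c ≤ a
      c≤a = All.lookup D≤a c∈D
      b+c≡a : b + c ≡ a
      b+c≡a = trans (cong (_+ c) b≡a∸c) (m∸n+n≡m c≤a)
      count-b : count b (b ∷ rest') ≡ count c D
      count-b = begin
        count b (b ∷ rest')           ≡⟨ count-compl b≢0 ⟩
        count b (map (a ∸_) D)        ≡⟨ cong (λ z → count z (map (a ∸_) D)) b≡a∸c ⟩
        count (a ∸ c) (map (a ∸_) D)  ≡⟨ count-map-∸ D D≤a c≤a ⟩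
        count c D                     ∎
        where open ≡-Reasoning
      c≤ : ∀ {y} → y ∈ D → c ≤ y
      c≤ {y} y∈D with y ≟ a
      ... | yes refl = c≤a
      ... | no  y≢a  = ∸-cancelʳ-≤ c≤a (subst (a ∸ y ≤_) b≡a∸c a∸y≤b)
        where
        y≤a = All.lookup D≤a y∈D
        a∸y≢0 : a ∸ y ≢ 0
        a∸y≢0 = m>n⇒m∸n≢0 (≤∧≢⇒< y≤a y≢a)
        a∸y∈ : a ∸ y ∈ b ∷ rest'
        a∸y∈ = ∈-compl a∸y≢0 (subst (0 <_) (sym (count-map-∸ D D≤a y≤a)) (∈⇒count-pos y∈D))
        a∸y≤b : a ∸ y ≤ b
        a∸y≤b = All.lookup (≤-refl ∷ rest'≤b) a∸y∈

  false≢true : false ≢ true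
  false≢true ()

  maxList-cons : ∀ k xs → maxList (k ∷ xs) ≡ just (foldl _⊔_ k xs)
  maxList-cons k []       = refl
  maxList-cons k (x ∷ xs) = maxList-cons (k ⊔ x) xs

  maxList-∷ʳ-upper : ∀ xs {n} → (∀ {k} → maxList xs ≡ just k → k ≤ n) → maxList (xs ∷ʳ n) ≡ just n
  maxList-∷ʳ-upper []       _     = refl
  maxList-∷ʳ-upper (x ∷ xs) {n} xs≤n = trans (maxList-cons x (xs ∷ʳ n))
    (cong just (trans (foldl-∷ʳ _⊔_ x n xs) (m≤n⇒m⊔n≡n (xs≤n (maxList-cons x xs)))))

  filter-upTo-suc : ∀ {P : ℕ → Set} (P? : Decidable P) n →
    filter P? (upTo (suc n)) ≡ filter P? (upTo n) ++ filter P? (n ∷ [])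
  filter-upTo-suc P? n = trans (cong (filter P?) (sym (upTo-∷ʳ n))) (filter-++ P? (upTo n) (n ∷ []))

  module _ (S : NumericalSet) where

    isGap? : Decidable (λ n → T (not (mem S n)))
    isGap? n = T? (not (mem S n))

    gapsBelow : ℕ → List ℕ
    gapsBelow n = filter isGap? (upTo n)

    membersBelow : ℕ → ℕ
    membersBelow zero    = 0
    membersBelow (suc n) = if mem S n then suc (membersBelow n) else membersBelow n

    rowsBelow : ℕ → List ℕ
    rowsBelow zero    = []
    rowsBelow (suc n) = if mem S n then rowsBelow n else membersBelow n ∷ rowsBelow n

    largestGapBelow : ℕ → Maybe ℕ
    largestGapBelow zero    = nothing
    largestGapBelow (suc n) = if mem S n then largestGapBelow n else just n

    countBelow≡membersBelow : ∀ n → countBelow S n ≡ membersBelow n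
    countBelow≡membersBelow zero    = refl
    countBelow≡membersBelow (suc n) =
      trans (cong length (filter-upTo-suc (λ k → T? (mem S k)) n))
            (trans (length-++ (filter (λ k → T? (mem S k)) (upTo n))) last-step)
      where
      last-step : countBelow S n + length (filter (λ k → T? (mem S k)) (n ∷ [])) ≡ membersBelow (suc n)
      last-step with mem S n
      ... | true  = trans (+-comm (countBelow S n) 1) (cong suc (countBelow≡membersBelow n))
      ... | false = trans (+-identityʳ _) (countBelow≡membersBelow n)

    diagram-gapsBelow : ∀ n → map (countBelow S) (reverse (gapsBelow n)) ≡ rowsBelow n
    diagram-gapsBelow zero    = refl
    diagram-gapsBelow (suc n) =
      trans (cong (map (countBelow S) ∘ reverse) (filter-upTo-suc isGap? n))
            (trans (cong (map (countBelow S)) (reverse-++ (gapsBelow n) (filter isGap? (n ∷ [])))) last-step)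
      where
      last-step : map (countBelow S) (reverse (filter isGap? (n ∷ [])) ++ reverse (gapsBelow n))
                  ≡ rowsBelow (suc n)
      last-step with mem S n
      ... | true  = diagram-gapsBelow n
      ... | false = cong₂ _∷_ (countBelow≡membersBelow n) (diagram-gapsBelow n)

    largestGapBelow-< : ∀ n {k} → largestGapBelow n ≡ just k → k < n
    largestGapBelow-< (suc n) eq with mem S n
    ... | true  = m<n⇒m<1+n (largestGapBelow-< n eq)
    ... | false with just-injective eq
    ...   | refl = ≤-refl

    maxList-gapsBelow : ∀ n → maxList (gapsBelow n) ≡ largestGapBelow n
    maxList-gapsBelow zero    = refl
    maxList-gapsBelow (suc n) = trans (cong maxList (filter-upTo-suc isGap? n)) last-step
      where
      last-step : maxList (gapsBelow n ++ filter isGap? (n ∷ [])) ≡ largestGapBelow (suc n)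
      last-step with mem S n
      ... | true  = trans (cong maxList (++-identityʳ (gapsBelow n))) (maxList-gapsBelow n)
      ... | false = maxList-∷ʳ-upper (gapsBelow n)
                      (λ eq → <⇒≤ (largestGapBelow-< n (trans (sym (maxList-gapsBelow n)) eq)))

    largestGapBelow-nothing : ∀ n → largestGapBelow n ≡ nothing → rowsBelow n ≡ []
    largestGapBelow-nothing zero    _  = refl
    largestGapBelow-nothing (suc n) eq with mem S n
    ... | true = largestGapBelow-nothing n eq

    largestGapBelow-just : ∀ n {f} → largestGapBelow n ≡ just f →
      mem S f ≡ false × rowsBelow n ≡ membersBelow f ∷ rowsBelow f
    largestGapBelow-just (suc n) eq with mem S n in n∉S
    ... | true  = largestGapBelow-just n eq
    ... | false with just-injective eq
    ...   | refl = n∉S , refl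

    membersBelow+length-rowsBelow : ∀ n → membersBelow n + length (rowsBelow n) ≡ n
    membersBelow+length-rowsBelow zero    = refl
    membersBelow+length-rowsBelow (suc n) with mem S n
    ... | true  = cong suc (membersBelow+length-rowsBelow n)
    ... | false = trans (+-suc (membersBelow n) _) (cong suc (membersBelow+length-rowsBelow n))

    membersBelow-≤-suc : ∀ n → membersBelow n ≤ membersBelow (suc n)
    membersBelow-≤-suc n with mem S n
    ... | true  = n≤1+n _
    ... | false = ≤-refl

    membersBelow-mono : ∀ {m n} → m ≤ n → membersBelow m ≤ membersBelow n
    membersBelow-mono {n = zero}  z≤n = ≤-refl
    membersBelow-mono {n = suc n} m≤n with m≤n⇒m<n∨m≡n m≤n
    ... | inj₁ m<1+n = ≤-trans (membersBelow-mono (≤-pred m<1+n)) (membersBelow-≤-suc n)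
    ... | inj₂ refl  = ≤-refl

    membersBelow-1 : membersBelow 1 ≡ 1
    membersBelow-1 rewrite zero∈ S = refl

    membersBelow-positive : ∀ {n} → 0 < n → 0 < membersBelow n
    membersBelow-positive {n} 0<n = subst (_≤ membersBelow n) membersBelow-1 (membersBelow-mono 0<n)

    gap-positive : ∀ {n} → mem S n ≡ false → 0 < n
    gap-positive {zero}  0∉S = ⊥-elim (false≢true (trans (sym 0∉S) (zero∈ S)))
    gap-positive {suc n} _   = s≤s z≤n

    rowsBelow-bounded : ∀ n → All (_≤ membersBelow n) (rowsBelow n)
    rowsBelow-bounded zero    = []
    rowsBelow-bounded (suc n) with mem S n
    ... | true  = All.map m≤n⇒m≤1+n (rowsBelow-bounded n)
    ... | false = ≤-refl ∷ rowsBelow-bounded n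

    rowsBelow-positive : ∀ n → All (0 <_) (rowsBelow n)
    rowsBelow-positive zero    = []
    rowsBelow-positive (suc n) with mem S n in n∉S
    ... | true  = rowsBelow-positive n
    ... | false = membersBelow-positive (gap-positive n∉S) ∷ rowsBelow-positive n

    rowsBelow-[] : ∀ n → rowsBelow n ≡ [] → ∀ {j} → j < n → mem S j ≡ true
    rowsBelow-[] (suc n) eq {j} j<1+n with mem S n in n∈S
    ... | true with m<1+n⇒m<n∨m≡n j<1+n
    ...   | inj₁ j<n = rowsBelow-[] n eq j<n
    ...   | inj₂ refl = n∈S

    largestMemBelow-mem : ∀ {j} → mem S j ≡ true → largestMemBelow S j ≡ j
    largestMemBelow-mem {zero}  _   = refl
    largestMemBelow-mem {suc j} j∈S rewrite j∈S = refl

    largestMemBelow-gap : ∀ {j} → mem S j ≡ false → largestMemBelow S j ≡ largestMemBelow S (j ∸ 1)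
    largestMemBelow-gap {zero}  _   = refl
    largestMemBelow-gap {suc j} j∉S rewrite j∉S = refl

    -- The gaps in (largestMemBelow S (f ∸ 1), f] are those with as many members below them as f.
    largestMemBelow+count-rows : ∀ {f} → mem S f ≡ false →
      largestMemBelow S (f ∸ 1) + count (membersBelow f) (membersBelow f ∷ rowsBelow f) ≡ f
    largestMemBelow+count-rows {zero}  0∉S = ⊥-elim (<-irrefl refl (gap-positive 0∉S))
    largestMemBelow+count-rows {suc j} _ with mem S j in j∈S
    ... | true  = begin
      largestMemBelow S j + count (suc (membersBelow j)) (suc (membersBelow j) ∷ rowsBelow j)
        ≡⟨ cong₂ _+_ (largestMemBelow-mem j∈S) (count-head (suc (membersBelow j)) (rowsBelow j)) ⟩
      j + suc (count (suc (membersBelow j)) (rowsBelow j))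
        ≡⟨ cong (λ c → j + suc c) (count-absent (rowsBelow j) (All.map s≤s (rowsBelow-bounded j))) ⟩
      j + 1
        ≡⟨ +-comm j 1 ⟩
      suc j ∎
      where open ≡-Reasoning
    ... | false = begin
      largestMemBelow S j + count (membersBelow j) (membersBelow j ∷ membersBelow j ∷ rowsBelow j)
        ≡⟨ cong₂ _+_ (largestMemBelow-gap j∈S) (count-head (membersBelow j) (membersBelow j ∷ rowsBelow j)) ⟩
      largestMemBelow S (j ∸ 1) + suc (count (membersBelow j) (membersBelow j ∷ rowsBelow j))
        ≡⟨ +-suc _ _ ⟩
      suc (largestMemBelow S (j ∸ 1) + count (membersBelow j) (membersBelow j ∷ rowsBelow j))
        ≡⟨ cong suc (largestMemBelow+count-rows j∈S) ⟩
      suc j ∎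
      where open ≡-Reasoning

    IsFirstMemFrom : ℕ → ℕ → Set
    IsFirstMemFrom k m = k ≤ m × mem S m ≡ true × (∀ {j} → k ≤ j → j < m → mem S j ≡ false)

    firstMemFrom-spec : ∀ fuel k → bound S ≤ fuel + k → IsFirstMemFrom k (firstMemFrom S fuel k)
    firstMemFrom-spec zero       k bound≤k = ≤-refl , cofinite S k bound≤k , λ k≤j j<k → ⊥-elim (<⇒≱ j<k k≤j)
    firstMemFrom-spec (suc fuel) k bound≤ with mem S k in k∈S
    ... | true  = ≤-refl , k∈S , λ k≤j j<k → ⊥-elim (<⇒≱ j<k k≤j)
    ... | false with firstMemFrom-spec fuel (suc k) (subst (bound S ≤_) (sym (+-suc fuel k)) bound≤)
    ...   | k<m , m∈S , gaps = <⇒≤ k<m , m∈S , gaps′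
      where
      gaps′ : ∀ {j} → k ≤ j → j < firstMemFrom S fuel (suc k) → mem S j ≡ false
      gaps′ k≤j j<m with m≤n⇒m<n∨m≡n k≤j
      ... | inj₁ k<j  = gaps k<j j<m
      ... | inj₂ refl = k∈S

    multiplicity-spec : IsFirstMemFrom 1 (multiplicity S)
    multiplicity-spec = firstMemFrom-spec (bound S) 1 (m≤m+n (bound S) 1)

    multiplicity≡1 : mem S 1 ≡ true → multiplicity S ≡ 1
    multiplicity≡1 1∈S with m≤n⇒m<n∨m≡n (proj₁ multiplicity-spec)
    ... | inj₁ 1<m = ⊥-elim (false≢true (trans (sym (proj₂ (proj₂ multiplicity-spec) ≤-refl 1<m)) 1∈S))
    ... | inj₂ 1≡m = sym 1≡m

    module _ {m} (first : IsFirstMemFrom 1 m) where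

      private
        1≤m = proj₁ first
        m∈S = proj₁ (proj₂ first)
        below-m-gap = proj₂ (proj₂ first)

      count-1-rowsBelow-upTo-first : ∀ {n} → 0 < n → n ≤ m →
        membersBelow n ≡ 1 × suc (count 1 (rowsBelow n)) ≡ n
      count-1-rowsBelow-upTo-first {suc zero}    _ _ rewrite zero∈ S = refl , refl
      count-1-rowsBelow-upTo-first {suc (suc k)} _ 2+k≤m
        with count-1-rowsBelow-upTo-first {suc k} (s≤s z≤n) (<⇒≤ 2+k≤m)
      ... | members≡1 , count≡ rewrite below-m-gap (s≤s z≤n) 2+k≤m =
        members≡1 , cong suc (trans (cong (λ x → count 1 (x ∷ rowsBelow (suc k))) members≡1)
                                    (trans (count-head 1 (rowsBelow (suc k))) count≡))

      count-1-rowsBelow-beyond-first : ∀ d → suc (count 1 (rowsBelow (d + m))) ≡ m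
      count-1-rowsBelow-beyond-first zero     = proj₂ (count-1-rowsBelow-upTo-first 1≤m ≤-refl)
      count-1-rowsBelow-beyond-first (suc d) with mem S (d + m) in d+m∈S
      ... | true  = count-1-rowsBelow-beyond-first d
      ... | false = trans (cong suc (count-≢ (rowsBelow (d + m)) (1≢members d d+m∈S)))
                          (count-1-rowsBelow-beyond-first d)
        where
        members-m+1 : membersBelow (suc m) ≡ 2
        members-m+1 rewrite m∈S = cong suc (proj₁ (count-1-rowsBelow-upTo-first 1≤m ≤-refl))
        1≢members : ∀ d → mem S (d + m) ≡ false → 1 ≢ membersBelow (d + m)
        1≢members zero     m∉S _  = false≢true (trans (sym m∉S) m∈S)
        1≢members (suc d′) _   1≡ = <-irrefl 1≡
          (subst (_≤ membersBelow (suc d′ + m)) members-m+1 (membersBelow-mono (s≤s (m≤n+m m d′))))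

  module _ (S : NumericalSet) where

    youngDiagram≡rowsBelow : youngDiagram S ≡ rowsBelow S (bound S)
    youngDiagram≡rowsBelow = diagram-gapsBelow S (bound S)

    genus≡length-youngDiagram : genus S ≡ length (youngDiagram S)
    genus≡length-youngDiagram =
      sym (trans (length-map (countBelow S) (reverse (gaps S))) (length-reverse (gaps S)))

    youngDiagram-positive : All (0 <_) (youngDiagram S)
    youngDiagram-positive = subst (All (0 <_)) (sym youngDiagram≡rowsBelow) (rowsBelow-positive S (bound S))

    youngDiagram-[]⇒full : youngDiagram S ≡ [] → IsFullℕ S
    youngDiagram-[]⇒full eq n with n <? bound S
    ... | yes n<bound = rowsBelow-[] S (bound S) (trans (sym youngDiagram≡rowsBelow) eq) n<bound
    ... | no  n≮bound = cofinite S n (≮⇒≥ n≮bound)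

    youngDiagram-[]⇒no-gaps : youngDiagram S ≡ [] → maxList (gaps S) ≡ nothing
    youngDiagram-[]⇒no-gaps eq with largestGapBelow S (bound S) in largest
    ... | nothing = trans (maxList-gapsBelow S (bound S)) largest
    ... | just f  with () ← trans (sym (proj₂ (largestGapBelow-just S (bound S) largest)))
                                 (trans (sym youngDiagram≡rowsBelow) eq)

    youngDiagram-∷ : ∀ {a rest} → youngDiagram S ≡ a ∷ rest →
      ∃ λ f → maxList (gaps S) ≡ just f × mem S f ≡ false × a ∷ rest ≡ membersBelow S f ∷ rowsBelow S f
    youngDiagram-∷ eq with largestGapBelow S (bound S) in largest
    ... | nothing with () ← trans (sym eq) (trans youngDiagram≡rowsBelow (largestGapBelow-nothing S (bound S) largest))
    ... | just f  = f , trans (maxList-gapsBelow S (bound S)) largest , f∉S ,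
                    trans (sym eq) (trans youngDiagram≡rowsBelow rows≡)
      where
      f∉S = proj₁ (largestGapBelow-just S (bound S) largest)
      rows≡ = proj₂ (largestGapBelow-just S (bound S) largest)

    module _ {a rest} (eq : youngDiagram S ≡ a ∷ rest) where

      private
        f     = proj₁ (youngDiagram-∷ eq)
        max   = proj₁ (proj₂ (youngDiagram-∷ eq))
        f∉S   = proj₁ (proj₂ (proj₂ (youngDiagram-∷ eq)))
        rows≡ = proj₂ (proj₂ (proj₂ (youngDiagram-∷ eq)))
        a≡    = ∷-injectiveˡ rows≡
        rest≡ = ∷-injectiveʳ rows≡
        f≡ : f ≡ a + length rest
        f≡ = sym (trans (cong₂ (λ a rest → a + length rest) a≡ rest≡) (membersBelow+length-rowsBelow S f))

      youngDiagram-head-max : All (_≤ a) rest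
      youngDiagram-head-max = subst₂ (λ a rest → All (_≤ a) rest) (sym a≡) (sym rest≡) (rowsBelow-bounded S f)

      maxList-gaps-youngDiagram : maxList (gaps S) ≡ just (a + length rest)
      maxList-gaps-youngDiagram = trans max (cong just f≡)

      largestMemBelow-youngDiagram :
        largestMemBelow S (a + length rest ∸ 1) + count a (a ∷ rest) ≡ a + length rest
      largestMemBelow-youngDiagram =
        subst (λ f′ → largestMemBelow S (f′ ∸ 1) + count a (a ∷ rest) ≡ f′) f≡
          (subst₂ (λ a rest → largestMemBelow S (f ∸ 1) + count a (a ∷ rest) ≡ f) (sym a≡) (sym rest≡)
                  (largestMemBelow+count-rows S f∉S))

    multiplicity≡suc-count-1 : mem S 1 ≡ false → multiplicity S ≡ suc (count 1 (youngDiagram S))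
    multiplicity≡suc-count-1 1∉S = begin
      multiplicity S
        ≡⟨ count-1-rowsBelow-beyond-first S (multiplicity-spec S) d ⟨
      suc (count 1 (rowsBelow S (d + multiplicity S)))
        ≡⟨ cong (λ n → suc (count 1 (rowsBelow S n))) (m∸n+n≡m m≤bound) ⟩
      suc (count 1 (rowsBelow S (bound S)))
        ≡⟨ cong (suc ∘ count 1) youngDiagram≡rowsBelow ⟨
      suc (count 1 (youngDiagram S))
        ∎
      where
      open ≡-Reasoning
      0<bound : 0 < bound S
      0<bound with bound S in bound≡
      ... | zero  = ⊥-elim (false≢true (trans (sym 1∉S) (cofinite S 1 (subst (_≤ 1) (sym bound≡) z≤n))))
      ... | suc _ = s≤s z≤n
      m≤bound : multiplicity S ≤ bound S
      m≤bound = ≮⇒≥ λ bound<m → false≢true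
        (trans (sym (proj₂ (proj₂ (multiplicity-spec S)) 0<bound bound<m)) (cofinite S (bound S) ≤-refl))
      d = bound S ∸ multiplicity S

  1∉S⇒1∈youngDiagram : ∀ S → mem S 1 ≡ false → 1 ∈ youngDiagram S
  1∉S⇒1∈youngDiagram S 1∉S = count-pos⇒∈ (youngDiagram S) (≤-pred 2≤m)
    where
    m-spec = multiplicity-spec S
    m≢1 : multiplicity S ≢ 1
    m≢1 m≡1 = false≢true (trans (sym 1∉S) (subst (λ k → mem S k ≡ true) m≡1 (proj₁ (proj₂ m-spec))))
    2≤m : 2 ≤ suc (count 1 (youngDiagram S))
    2≤m = subst (2 ≤_) (multiplicity≡suc-count-1 S 1∉S) (≤∧≢⇒< (proj₁ m-spec) (m≢1 ∘ sym))

open YoungDiagrams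

open import Data.Bool.Properties using (¬-not) renaming (_≟_ to _≟ᵇ_)
open import Data.Nat as ℕ using (zero; suc; s≤s)
import Data.Nat.Properties as ℕ
open import Data.Nat.Tactic.RingSolver using (solve-∀)
open import Data.Integer using (+_; -[1+_]; _+_; _-_; _≤_; _⊖_; +≤+; -≤+)
import Data.Integer.Properties as ℤ
open import Function.Bundles using (_⇔_; mk⇔)

m+n≡o⇒m≡o-n : ∀ {m n o} → m ℕ.+ n ≡ o → + m ≡ + o - + n
m+n≡o⇒m≡o-n {m} {n} refl = begin
  + m                  ≡⟨ cong +_ (sym (ℕ.m+n∸n≡m m n)) ⟩
  + (m ℕ.+ n ℕ.∸ n)    ≡⟨ sym (ℤ.⊖-≥ (ℕ.m≤n+m n m)) ⟩
  (m ℕ.+ n) ⊖ n        ≡⟨ sym (ℤ.m-n≡m⊖n (m ℕ.+ n) n) ⟩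
  + (m ℕ.+ n) - + n    ∎
  where open ≡-Reasoning

m+n≤o⇒m≤o-n : ∀ {m n o} → m ℕ.+ n ℕ.≤ o → + m ≤ + o - + n
m+n≤o⇒m≤o-n {m} m+n≤o =
  subst (+ m ≤_) (m+n≡o⇒m≡o-n (ℕ.m∸n+n≡m n≤o)) (+≤+ (ℕ.m+n≤o⇒m≤o∸n m m+n≤o))
  where n≤o = ℕ.m+n≤o⇒n≤o m m+n≤o

m+q≤o+n⇒m-n≤o-q : ∀ {m n o q} → m ℕ.+ q ℕ.≤ o ℕ.+ n → + m - + n ≤ + o - + q
m+q≤o+n⇒m-n≤o-q {m} {n} {o} {q} m+q≤o+n = begin
  + m - + n               ≡⟨ ℤ.m-n≡m⊖n m n ⟩
  m ⊖ n                   ≡⟨ ℤ.+-cancelˡ-⊖ q m n ⟨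
  (q ℕ.+ m) ⊖ (q ℕ.+ n)   ≤⟨ ℤ.⊖-monoˡ-≤ (q ℕ.+ n) q+m≤n+o ⟩
  (n ℕ.+ o) ⊖ (q ℕ.+ n)   ≡⟨ cong ((n ℕ.+ o) ⊖_) (ℕ.+-comm q n) ⟩
  (n ℕ.+ o) ⊖ (n ℕ.+ q)   ≡⟨ ℤ.+-cancelˡ-⊖ n o q ⟩
  o ⊖ q                   ≡⟨ ℤ.m-n≡m⊖n o q ⟨
  + o - + q               ∎
  where
  open ℤ.≤-Reasoning
  q+m≤n+o = subst₂ ℕ._≤_ (ℕ.+-comm m q) (ℕ.+-comm o n) m+q≤o+n

m<n⇒m-1≤n-2 : ∀ {m n} → m ℕ.< n → + m - + 1 ≤ + n - + 2
m<n⇒m-1≤n-2 {m} {n} m<n =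
  m+q≤o+n⇒m-n≤o-q {m} {1} {n} {2} (subst₂ ℕ._≤_ (ℕ.+-comm 2 m) (ℕ.+-comm 1 n) (s≤s m<n))

-1≤m-1 : ∀ m → -[1+ 0 ] ≤ + m - + 1
-1≤m-1 zero    = ℤ.≤-refl
-1≤m-1 (suc m) = -≤+

m+n≡o⇒p+n≡q⇒m≡o+p-q : ∀ {m n o p q} → m ℕ.+ n ≡ o → p ℕ.+ n ≡ q → + m ≡ + o + + p - + q
m+n≡o⇒p+n≡q⇒m≡o+p-q {m} {n} {p = p} refl refl = m+n≡o⇒m≡o-n (rearrange m p n)
  where
  rearrange : ∀ x y z → x ℕ.+ (y ℕ.+ z) ≡ x ℕ.+ z ℕ.+ y
  rearrange = solve-∀

m≤o-n-with-equality-iff : ∀ {P : Set} {x m y} → Dec P →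
  (P → x ℕ.+ m ≡ y) → (¬ P → m ≡ 1 × suc x ℕ.< y) →
  (+ x ≤ + y - + m) × ((+ x ≡ + y - + m) ⇔ P)
m≤o-n-with-equality-iff (yes p) equal _ = ℤ.≤-reflexive x≡ , mk⇔ (λ _ → p) (λ _ → x≡)
  where x≡ = m+n≡o⇒m≡o-n (equal p)
m≤o-n-with-equality-iff {x = x} {y = y} (no ¬p) _ gap with gap ¬p
... | refl , 1+x<y = ℤ.≤-trans (+≤+ (ℕ.n≤1+n x)) 1+x≤y-1 , mk⇔ (⊥-elim ∘ x≢y-1) (⊥-elim ∘ ¬p)
  where
  1+x≤y-1 : + suc x ≤ + y - + 1
  1+x≤y-1 = m+n≤o⇒m≤o-n (subst (ℕ._≤ y) (ℕ.+-comm 1 (suc x)) 1+x<y)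
  x≢y-1 : + x ≢ + y - + 1
  x≢y-1 x≡ = ℕ.<-irrefl refl (ℤ.drop‿+≤+ (subst (+ suc x ≤_) (sym x≡) 1+x≤y-1))

frobenius-nothing : ∀ S → maxList (gaps S) ≡ nothing → frobenius S ≡ -[1+ 0 ]
frobenius-nothing S eq rewrite eq = refl

frobenius-just : ∀ S {f} → maxList (gaps S) ≡ just f → frobenius S ≡ + f
frobenius-just S eq rewrite eq = refl

base-just : ∀ S {f} → maxList (gaps S) ≡ just f → base S ≡ + largestMemBelow S (f ℕ.∸ 1)
base-just S eq rewrite eq = refl

youngDiagram-[]⇒frobenius : ∀ S → youngDiagram S ≡ [] → frobenius S ≡ -[1+ 0 ]
youngDiagram-[]⇒frobenius S eq = frobenius-nothing S (youngDiagram-[]⇒no-gaps S eq)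

frobenius-youngDiagram : ∀ S {a rest} → youngDiagram S ≡ a ∷ rest → frobenius S ≡ + (a ℕ.+ length rest)
frobenius-youngDiagram S eq = frobenius-just S (maxList-gaps-youngDiagram S eq)

base-youngDiagram : ∀ S {a rest} → youngDiagram S ≡ a ∷ rest →
  base S ≡ + largestMemBelow S (a ℕ.+ length rest ℕ.∸ 1)
base-youngDiagram S eq = base-just S (maxList-gaps-youngDiagram S eq)

module _ (S : NumericalSet) {a rest} (D≡ : youngDiagram S ≡ a ∷ rest) where

  private
    β = largestMemBelow S (a ℕ.+ length rest ℕ.∸ 1)
    base≡ = base-youngDiagram S D≡
    β+r≡ = largestMemBelow-youngDiagram S D≡

  base-1≤frobenius-2 : base S - + 1 ≤ frobenius S - + 2
  base-1≤frobenius-2 = subst₂ (λ B F → B - + 1 ≤ F - + 2) (sym base≡) (sym (frobenius-youngDiagram S D≡))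
    (m<n⇒m-1≤n-2 (subst (β ℕ.<_) β+r≡ (ℕ.m<m+n β (count-head-positive a rest))))

  genus-complement : ∀ S̃ → youngDiagram S̃ ≡ complementDiagram (a ∷ rest) →
    + genus S̃ ≡ + genus S + base S - frobenius S
  genus-complement S̃ D̃≡ = begin
    + genus S̃                                         ≡⟨ cong +_ genus̃≡ ⟩
    + length (complementDiagram (a ∷ rest))           ≡⟨ m+n≡o⇒p+n≡q⇒m≡o+p-q length≡ β+r≡ ⟩
    + suc (length rest) + + β - + (a ℕ.+ length rest) ≡⟨ cong₂ _-_ (cong₂ _+_ (cong +_ genus≡) base≡) F≡ ⟨
    + genus S + base S - frobenius S                  ∎
    where
    open ≡-Reasoning
    F≡ = frobenius-youngDiagram S D≡
    length≡ = length-complementDiagram (youngDiagram-head-max S D≡)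
    genus̃≡ : genus S̃ ≡ length (complementDiagram (a ∷ rest))
    genus̃≡ = trans (genus≡length-youngDiagram S̃) (cong length D̃≡)
    genus≡ : genus S ≡ suc (length rest)
    genus≡ = trans (genus≡length-youngDiagram S) (cong length D≡)

  frobenius-complement-[] : ∀ S̃ → complementDiagram (a ∷ rest) ≡ [] → youngDiagram S̃ ≡ [] →
    (frobenius S̃ ≤ base S - + 1) × (mem S 1 ≡ false → frobenius S̃ ≡ base S - + 1)
  frobenius-complement-[] S̃ compl≡ D̃≡ =
    subst₂ _≤_ (sym F̃≡) (sym base-1≡) (-1≤m-1 β) ,
    λ 1∉S → trans F̃≡ (trans (cong (λ b → + b - + 1) (sym (β≡0 1∉S))) (sym base-1≡))
    where
    F̃≡ = youngDiagram-[]⇒frobenius S̃ D̃≡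
    base-1≡ : base S - + 1 ≡ + β - + 1
    base-1≡ = cong (_- + 1) base≡
    all-top : count a (a ∷ rest) ≡ suc (length rest)
    all-top = subst (λ C → length C ℕ.+ count a (a ∷ rest) ≡ suc (length rest)) compl≡
                    (length-complementDiagram (youngDiagram-head-max S D≡))
    -- S̃ = ℕ means that every row of S has length a, and 1 ∉ S gives a row of length 1.
    β≡0 : mem S 1 ≡ false → β ≡ 0
    β≡0 1∉S = ℕ.+-cancelʳ-≡ (count a (a ∷ rest)) β 0
      (trans β+r≡ (trans (cong (ℕ._+ length rest) (sym 1≡a)) (sym all-top)))
      where
      1≡a = count≡length⇒all-≡ (a ∷ rest) all-top (subst (1 ∈_) D≡ (1∉S⇒1∈youngDiagram S 1∉S))

  module _ (S̃ : NumericalSet) {b rest'} (compl≡ : complementDiagram (a ∷ rest) ≡ b ∷ rest')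
           (D̃≡ : youngDiagram S̃ ≡ b ∷ rest') where

    private
      shortest = complementDiagram-head (youngDiagram-head-max S D≡) compl≡ (youngDiagram-head-max S̃ D̃≡)
      c = proj₁ shortest
      c∈ = proj₁ (proj₂ shortest)
      c-min = proj₁ (proj₂ (proj₂ shortest))
      b+c≡a = proj₁ (proj₂ (proj₂ (proj₂ shortest)))
      q≡ = proj₂ (proj₂ (proj₂ (proj₂ shortest)))
      f̃ = b ℕ.+ length rest'

      0<c : 0 ℕ.< c
      0<c = All.lookup (subst (All (0 ℕ.<_)) D≡ (youngDiagram-positive S)) c∈

      c≡1 : mem S 1 ≡ false → c ≡ 1
      c≡1 1∉S = ℕ.≤-antisym (All.lookup c-min (subst (1 ∈_) D≡ (1∉S⇒1∈youngDiagram S 1∉S))) 0<c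

      f̃+c≡β : f̃ ℕ.+ c ≡ β
      f̃+c≡β = ℕ.+-cancelʳ-≡ r (f̃ ℕ.+ c) β (begin
        b ℕ.+ length rest' ℕ.+ c ℕ.+ r      ≡⟨ rearrange b (length rest') c r ⟩
        (b ℕ.+ c) ℕ.+ (length rest' ℕ.+ r) ≡⟨ cong₂ ℕ._+_ b+c≡a (ℕ.suc-injective len+r≡) ⟩
        a ℕ.+ length rest                  ≡⟨ sym β+r≡ ⟩
        β ℕ.+ r                            ∎)
        where
        open ≡-Reasoning
        r = count a (a ∷ rest)
        len+r≡ = subst (λ C → length C ℕ.+ r ≡ suc (length rest)) compl≡
                       (length-complementDiagram (youngDiagram-head-max S D≡))
        rearrange : ∀ x y z w → x ℕ.+ y ℕ.+ z ℕ.+ w ≡ (x ℕ.+ z) ℕ.+ (y ℕ.+ w)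
        rearrange = solve-∀

      f̃<β : f̃ ℕ.< β
      f̃<β = subst (f̃ ℕ.<_) f̃+c≡β (ℕ.m<m+n f̃ 0<c)

    frobenius-complement-∷ : (frobenius S̃ ≤ base S - + 1) × (mem S 1 ≡ false → frobenius S̃ ≡ base S - + 1)
    frobenius-complement-∷ =
      subst₂ _≤_ (sym F̃≡) (sym base-1≡) (m+n≤o⇒m≤o-n (subst (ℕ._≤ β) (ℕ.+-comm 1 f̃) f̃<β)) ,
      λ 1∉S → trans F̃≡ (trans (m+n≡o⇒m≡o-n (subst (λ c → f̃ ℕ.+ c ≡ β) (c≡1 1∉S) f̃+c≡β))
                             (sym base-1≡))
      where
      F̃≡ = frobenius-youngDiagram S̃ D̃≡
      base-1≡ : base S - + 1 ≡ + β - + 1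
      base-1≡ = cong (_- + 1) base≡

    base-complement : (base S̃ ≤ base S - + multiplicity S)
                    × ((base S̃ ≡ base S - + multiplicity S) ⇔ (mem S 1 ≡ false))
    base-complement =
      subst₂ (λ B̃ B → (B̃ ≤ B - + multiplicity S) × ((B̃ ≡ B - + multiplicity S) ⇔ (mem S 1 ≡ false)))
             (sym basẽ≡) (sym base≡)
             (m≤o-n-with-equality-iff (mem S 1 ≟ᵇ false) equal gap)
      where
      β̃ = largestMemBelow S̃ (f̃ ℕ.∸ 1)
      basẽ≡ = base-youngDiagram S̃ D̃≡
      β̃+q≡f̃ = largestMemBelow-youngDiagram S̃ D̃≡
      q = count b (b ∷ rest')
      equal : mem S 1 ≡ false → β̃ ℕ.+ multiplicity S ≡ β
      equal 1∉S = begin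
        β̃ ℕ.+ multiplicity S                    ≡⟨ cong (β̃ ℕ.+_) (multiplicity≡suc-count-1 S 1∉S) ⟩
        β̃ ℕ.+ suc (count 1 (youngDiagram S))    ≡⟨ cong (λ D → β̃ ℕ.+ suc (count 1 D)) D≡ ⟩
        β̃ ℕ.+ suc (count 1 (a ∷ rest))          ≡⟨ cong (λ x → β̃ ℕ.+ suc (count x (a ∷ rest))) (sym (c≡1 1∉S)) ⟩
        β̃ ℕ.+ suc (count c (a ∷ rest))          ≡⟨ cong (λ x → β̃ ℕ.+ suc x) (sym q≡) ⟩
        β̃ ℕ.+ suc q                             ≡⟨ ℕ.+-suc β̃ q ⟩
        suc (β̃ ℕ.+ q)                           ≡⟨ cong suc β̃+q≡f̃ ⟩
        suc f̃                                   ≡⟨ ℕ.+-comm 1 f̃ ⟩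
        f̃ ℕ.+ 1                                 ≡⟨ cong (f̃ ℕ.+_) (sym (c≡1 1∉S)) ⟩
        f̃ ℕ.+ c                                 ≡⟨ f̃+c≡β ⟩
        β                                       ∎
        where open ≡-Reasoning
      gap : ¬ mem S 1 ≡ false → multiplicity S ≡ 1 × suc β̃ ℕ.< β
      gap 1∈S = multiplicity≡1 S (¬-not 1∈S) , ℕ.≤-trans (s≤s β̃<f̃) f̃<β
        where
        β̃<f̃ : β̃ ℕ.< f̃
        β̃<f̃ = subst (β̃ ℕ.<_) β̃+q≡f̃ (ℕ.m<m+n β̃ (count-head-positive b rest'))

proposition2p3 : (S S̃ : NumericalSet) → ¬ IsFullℕ S → IsComplement S S̃ →
    ((frobenius S̃ ≤ base S - + 1) × (base S - + 1 ≤ frobenius S - + 2)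
      × (mem S 1 ≡ false → frobenius S̃ ≡ base S - + 1))
    × (+ genus S̃ ≡ + genus S + base S - frobenius S)
    × (¬ IsFullℕ S̃ →
        (base S̃ ≤ base S - + multiplicity S)
        × ((base S̃ ≡ base S - + multiplicity S) ⇔ (mem S 1 ≡ false)))
proposition2p3 S S̃ S≢ℕ S̃≡ with youngDiagram S in D≡
... | [] = ⊥-elim (S≢ℕ (youngDiagram-[]⇒full S D≡))
... | a ∷ rest with youngDiagram S̃ in D̃≡
...   | [] =
  (proj₁ F̃ , base-1≤frobenius-2 S D≡ , proj₂ F̃) , genus-complement S D≡ S̃ (trans D̃≡ S̃≡) ,
  λ S̃≢ℕ → ⊥-elim (S̃≢ℕ (youngDiagram-[]⇒full S̃ D̃≡))
  where F̃ = frobenius-complement-[] S D≡ S̃ (sym S̃≡) D̃≡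
...   | b ∷ rest' =
  (proj₁ F̃ , base-1≤frobenius-2 S D≡ , proj₂ F̃) , genus-complement S D≡ S̃ (trans D̃≡ S̃≡) ,
  λ _ → base-complement S D≡ S̃ (sym S̃≡) D̃≡
  where F̃ = frobenius-complement-∷ S D≡ S̃ (sym S̃≡) D̃≡
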